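{- Let $a,b\ge0$, $0\le q\le a$, $0\le r\le b$ and $v=v^{a,b,q,r}\in V^{a,b}$. Then for any non-zero integer $h$, the projection of $u^h(v)$ to the highest $S$-weight space of $V^{a,b}$ is $(2h)^q\,v^{a,b,0,r}$.
   Context: $G=\mathrm{GSp}_4$ defined by $g^tJg=\mu J$, $J=\begin{pmatrix}0&0&0&1\\0&0&1&0\\0&-1&0&0\\-1&0&0&0\end{pmatrix}$; $V^{a,b}$ is the irreducible representation with highest weight $(a+b)\chi_1+a\chi_2$ (upper-triangular Borel, $\chi_i$ the $i$-th diagonal entry). $S$ is the torus $\{\mathrm{diag}(x,x,1,1)\}$; $V^{a,b}$ is the direct sum of its $S$-weight spaces (weights $x\mapsto x^j$ with $0\le j\le2a+b$), and the highest $S$-weight space is the one with $j=2a+b$. $u=\begin{pmatrix}1&0&1&0\\0&1&0&1\\0&0&1&0\\0&0&0&1\end{pmatrix}\in G(\mathbf{Z})$. Cartan products $V^{a,b}\otimes V^{a',b'}\to V^{a+a',b+b'}$ are the $G$-maps sending chosen highest-weight vectors to the chosen highest-weight vector. With $V^{0,1}$ the standard representation (basis $e_1,\dots,e_4$, $G$ acting on column vectors) and $V^{1,0}\subset\wedge^2V^{0,1}$ the kernel of contraction with the symplectic form, put $v=e_1$, $v'=e_2$, $w=e_1\wedge e_2$, $w'=e_1\wedge e_4-e_2\wedge e_3$, and $v^{a,b,q,r}=w^{a-q}\cdot v^{b-r}\cdot(w')^q\cdot(v')^r$ (Cartan products). -}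

module Defs where

open import Data.Nat using (ℕ; zero; suc; _∸_; _≤_)
open import Data.Integer using (ℤ; +_; -[1+_])
open import Data.Rational using (ℚ; _+_; _*_; _-_; -_; 0ℚ; 1ℚ; _/_)
open import Data.Fin using (Fin; zero; suc)
open import Data.List using (List; []; _∷_)
open import Data.Vec using (Vec; []; _∷_)
open import Data.Product using (Σ; _×_; _,_)
open import Relation.Binary.PropositionalEquality using (_≡_; _≢_)

ℤ→ℚ : ℤ → ℚ
ℤ→ℚ z = z / 1

_^_ : ℚ → ℕ → ℚ
x ^ zero  = 1ℚ
x ^ suc n = x * (x ^ n)

Vec4 : Set
Vec4 = Fin 4 → ℚ

Mat4 : Set
Mat4 = Fin 4 → Fin 4 → ℚ

sum4 : (Fin 4 → ℚ) → ℚ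
sum4 f = f zero + (f (suc zero) + (f (suc (suc zero)) + f (suc (suc (suc zero)))))

⟪_,_⟫ : Vec4 → Vec4 → ℚ
⟪ α , x ⟫ = sum4 (λ i → α i * x i)

_·ₘ_ : Mat4 → Mat4 → Mat4
(g ·ₘ k) i j = sum4 (λ l → g i l * k l j)

_·ᵣ_ : Vec4 → Mat4 → Vec4
(α ·ᵣ g) j = sum4 (λ i → α i * g i j)

transpose : Mat4 → Mat4
transpose g i j = g j i

δ : ∀ {n} → Fin n → Fin n → ℚ
δ zero zero = 1ℚ
δ (suc i) (suc j) = δ i j
δ _ _ = 0ℚ

idM : Mat4
idM = δ

negM : Mat4 → Mat4
negM g i j = - g i j

-- standard basis of the column vectors V^{0,1} = ℚ^4
e : Fin 4 → Vec4
e = idM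

e₁ e₂ e₃ e₄ : Vec4
e₁ = e zero
e₂ = e (suc zero)
e₃ = e (suc (suc zero))
e₄ = e (suc (suc (suc zero)))

J : Mat4
J zero (suc (suc (suc zero))) = 1ℚ
J (suc zero) (suc (suc zero)) = 1ℚ
J (suc (suc zero)) (suc zero) = - 1ℚ
J (suc (suc (suc zero))) zero = - 1ℚ
J _ _ = 0ℚ

symp : Vec4 → Vec4 → ℚ
symp x y = sum4 (λ i → x i * sum4 (λ j → J i j * y j))

u : Mat4
u zero (suc (suc zero)) = 1ℚ
u (suc zero) (suc (suc (suc zero))) = 1ℚ
u i j = idM i j

-- inverse of an element of Sp4 (multiplier 1): g⁻¹ = J⁻¹ gᵗ J = - J gᵗ J
spInv : Mat4 → Mat4
spInv g = negM ((J ·ₘ transpose g) ·ₘ J)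

matPow : Mat4 → ℕ → Mat4
matPow g zero = idM
matPow g (suc n) = g ·ₘ matPow g n

uPow : ℤ → Mat4
uPow (+ n) = matPow u n
uPow -[1+ n ] = matPow (spInv u) (suc n)

-- Model of representations: polynomial functions on the cone of
-- isotropic pairs (α , β) of row vectors (α J βᵗ = 0).
-- A vector x ∈ V^{a,b} is identified with the function
--   (α , β) ↦ ℓ(k⁻¹ x)  where α, β are rows 3, 4 of k⁻¹ (k ∈ G),
-- so that g ∈ G acts by (g·F)(α , β) = F (α g) (β g), and Cartan
-- products become pointwise products of functions.

Fn : Set
Fn = Vec4 → Vec4 → ℚ

Isotropic : Vec4 → Vec4 → Set
Isotropic α β = ⟪ α , (λ i → sum4 (λ j → J i j * β j)) ⟫ ≡ 0ℚ

_≈_ : Fn → Fn → Set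
F ≈ G = ∀ α β → Isotropic α β → F α β ≡ G α β

infix 4 _≈_

act : Mat4 → Fn → Fn
act g F α β = F (α ·ᵣ g) (β ·ᵣ g)

_⊕_ : Fn → Fn → Fn
(F ⊕ G) α β = F α β + G α β

_⊗_ : Fn → Fn → Fn
(F ⊗ G) α β = F α β * G α β

scale : ℚ → Fn → Fn
scale c F α β = c * F α β

zeroF : Fn
zeroF _ _ = 0ℚ

oneF : Fn
oneF _ _ = 1ℚ

_^ᶜ_ : Fn → ℕ → Fn
F ^ᶜ zero = oneF
F ^ᶜ suc n = F ⊗ (F ^ᶜ n)

-- V^{0,1}: x ↦ (α , β) ↦ β x   (lowest-weight functional e₄*)
embV : Vec4 → Fn
embV x α β = ⟪ β , x ⟫

-- elements of ∧² V^{0,1} as formal combinations Σ c (x ∧ y)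
Wedge2 : Set
Wedge2 = List (ℚ × Vec4 × Vec4)

contract : Wedge2 → ℚ
contract [] = 0ℚ
contract ((c , x , y) ∷ ω) = c * symp x y + contract ω

-- V^{1,0} = ker(contract) ⊂ ∧² V^{0,1}
V10 : Set
V10 = Σ Wedge2 (λ ω → contract ω ≡ 0ℚ)

-- ∧² V^{0,1}: x ∧ y ↦ coefficient of e₃ ∧ e₄ in (k⁻¹x) ∧ (k⁻¹y)
embW₀ : Wedge2 → Fn
embW₀ [] α β = 0ℚ
embW₀ ((c , x , y) ∷ ω) α β =
  c * (⟪ α , x ⟫ * ⟪ β , y ⟫ - ⟪ α , y ⟫ * ⟪ β , x ⟫) + embW₀ ω α β

embW : V10 → Fn
embW (ω , _) = embW₀ ω

v v′ : Fn
v  = embV e₁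
v′ = embV e₂

wω w′ω : Wedge2
wω  = (1ℚ , e₁ , e₂) ∷ []
w′ω = (1ℚ , e₁ , e₄) ∷ (- 1ℚ , e₂ , e₃) ∷ []

w w′ : Fn
w  = embW₀ wω
w′ = embW₀ w′ω

vabqr : ℕ → ℕ → ℕ → ℕ → Fn
vabqr a b q r = (w ^ᶜ (a ∸ q)) ⊗ ((v ^ᶜ (b ∸ r)) ⊗ ((w′ ^ᶜ q) ⊗ (v′ ^ᶜ r)))

-- V^{a,b}: span of Cartan products of a vectors of V^{1,0} and
-- b vectors of V^{0,1}

prodW : ∀ {n} → Vec V10 n → Fn
prodW [] = oneF
prodW (ω ∷ ωs) = embW ω ⊗ prodW ωs

prodV : ∀ {n} → Vec Vec4 n → Fn
prodV [] = oneF
prodV (x ∷ xs) = embV x ⊗ prodV xs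

Monomial : ℕ → ℕ → Set
Monomial a b = ℚ × Vec V10 a × Vec Vec4 b

evalMono : ∀ {a b} → Monomial a b → Fn
evalMono (c , ωs , xs) = scale c (prodW ωs ⊗ prodV xs)

sumMonos : ∀ {a b} → List (Monomial a b) → Fn
sumMonos [] = zeroF
sumMonos (m ∷ ms) = evalMono m ⊕ sumMonos ms

InV : ℕ → ℕ → Fn → Set
InV a b F = Σ (List (Monomial a b)) (λ ms → F ≈ sumMonos ms)

sMat : ℚ → Mat4
sMat x zero zero = x
sMat x (suc zero) (suc zero) = x
sMat x i j = idM i j

HasSWeight : ℕ → Fn → Set
HasSWeight j F = ∀ x → x ≢ 0ℚ → act (sMat x) F ≈ scale (x ^ j) F

sumUpTo : ℕ → (ℕ → Fn) → Fn
sumUpTo zero C = C zero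
sumUpTo (suc n) C = sumUpTo n C ⊕ C (suc n)

-- P is the projection of F ∈ V^{a,b} to the highest S-weight space
-- (weight 2a+b) of the decomposition V^{a,b} = ⊕_{0≤j≤2a+b} V^{a,b}_j
IsHighestSProj : ℕ → ℕ → Fn → Fn → Set
IsHighestSProj a b F P =
  Σ (ℕ → Fn) (λ C →
      (∀ j → j ≤ top → InV a b (C j) × HasSWeight j (C j))
    × (F ≈ sumUpTo top C)
    × (P ≈ C top))
  where
  top : ℕ
  top = 2 Data.Nat.* a Data.Nat.+ b

{-# OPTIONS --safe #-}
module Submission where

-- The powers u^h are the unipotent matrices U(h) with entries h at (1,3) and (2,4).  Acting on
-- the generators, U(t) fixes v, v′ and w and sends w′ to w′ + 2t·w; since G acts on Cartan
-- products factorwise, u^h(v^{a,b,q,r}) = w^{a-q} v^{b-r} (w′ + 2h·w)^q (v′)^r.  The binomial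
-- theorem splits this into the terms C(q,k) (2h)^k w^{a-q+k} v^{b-r} (w′)^{q-k} (v′)^r, and as
-- w has S-weight 2 while v, v′, w′ have S-weight 1, the k-th term has S-weight 2a+b-q+k.  So
-- these terms are the S-weight components, and the top one (k = q) is (2h)^q v^{a,b,0,r}.

open import Defs

-- An anonymous module, so that the ℚ operators opened in it do not clash with ℤ's _*_ in the
-- statement of lemma4p4p2.
module _ where
  open import Level using (0ℓ)
  open import Data.Nat as ℕ using (ℕ; zero; suc; _∸_)
  import Data.Nat.Properties as ℕ
  open import Data.Nat.Combinatorics using (_C_; nCn≡1)
  open import Data.Nat.Tactic.RingSolver using (solve-∀)
  open import Data.Integer as ℤ using (ℤ; +_; -[1+_])
  import Data.Integer.Properties as ℤ
  open import Data.Fin using (Fin; zero; suc; toℕ; _↑ˡ_; _↑ʳ_)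
  open import Data.Fin.Patterns using (0F; 1F; 2F; 3F)
  open import Data.Fin.Properties using (all?)
  open import Data.Rational using (ℚ; 0ℚ; 1ℚ; _+_; _*_; _-_; -_; _/_)
  open import Data.Rational.Literals using (fromℤ)
  open import Data.Rational.Properties
    using (_≟_; ↥p/↧p≡p; +-*-commutativeRing; +-comm; +-assoc; +-identityˡ; +-identityʳ; *-identityˡ; *-assoc; *-zeroʳ)
  open import Data.Rational.Solver using (module +-*-Solver)
  open +-*-Solver using (Polynomial; var; con; _:+_; _:*_; _:-_; _:=_; solve; prove)
  open import Data.Product using (_×_; _,_)
  open import Data.List using ([]; _∷_)
  open import Data.Vec using (Vec; []; _∷_; _++_; replicate)
  open import Function using (_∘_)
  open import Algebra.Bundles using (CommutativeSemiring; CommutativeRing)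
  open import Relation.Nullary.Decidable using (Dec; toWitness)
  open import Relation.Binary.PropositionalEquality
  open ≡-Reasoning

  ℚ-commutativeSemiring : CommutativeSemiring 0ℓ 0ℓ
  ℚ-commutativeSemiring = CommutativeRing.commutativeSemiring +-*-commutativeRing

  open import Algebra.Properties.CommutativeSemiring.Exp ℚ-commutativeSemiring
    using (^-homo-*; ^-distrib-*) renaming (_^_ to _^ᴿ_)
  open import Algebra.Properties.CommutativeSemiring.Binomial ℚ-commutativeSemiring
    using (binomialTerm; theorem)
  open import Algebra.Properties.Semiring.Sum (CommutativeSemiring.semiring ℚ-commutativeSemiring)
    using (sum⁺-syntax; sum-cong-≗; *-distribˡ-sum; *-distribʳ-sum)
  open import Algebra.Properties.Semiring.Mult (CommutativeSemiring.semiring ℚ-commutativeSemiring)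
    using (×-assoc-*) renaming (_×_ to _×ₙ_)

  infix 4 _≗ₘ_

  _≗ₘ_ : Mat4 → Mat4 → Set
  g ≗ₘ k = ∀ i j → g i j ≡ k i j

  _≗ₘ?_ : (g k : Mat4) → Dec (g ≗ₘ k)
  g ≗ₘ? k = all? λ i → all? λ j → g i j ≟ k i j

  sum4-cong : ∀ {f g : Fin 4 → ℚ} → f ≗ g → sum4 f ≡ sum4 g
  sum4-cong f≗g = cong₂ _+_ (f≗g 0F) (cong₂ _+_ (f≗g 1F) (cong₂ _+_ (f≗g 2F) (f≗g 3F)))

  ·ₘ-cong : ∀ {g g′ k k′} → g ≗ₘ g′ → k ≗ₘ k′ → g ·ₘ k ≗ₘ g′ ·ₘ k′
  ·ₘ-cong g≗g′ k≗k′ i j = sum4-cong λ l → cong₂ _*_ (g≗g′ i l) (k≗k′ l j)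

  ·ᵣ-congʳ : ∀ α {g k} → g ≗ₘ k → α ·ᵣ g ≗ α ·ᵣ k
  ·ᵣ-congʳ α g≗k j = sum4-cong λ i → cong (α i *_) (g≗k i j)

  U : ℚ → Mat4
  U t 0F 2F = t
  U t 1F 3F = t
  U t i j = δ i j

  -- Polynomial counterparts of the operations of Defs, with the same clauses: their semantics
  -- unfold definitionally to the ℚ-expressions, so the ring solver can verify identities between
  -- the coordinates of rows and matrices.
  module Mirror {n : ℕ} where
    Rowₚ : Set
    Rowₚ = Fin 4 → Polynomial n

    Matₚ : Set
    Matₚ = Fin 4 → Fin 4 → Polynomial n

    sum4ₚ : Rowₚ → Polynomial n
    sum4ₚ f = f 0F :+ (f 1F :+ (f 2F :+ f 3F))

    ⟪_,_⟫ₚ : Rowₚ → Rowₚ → Polynomial n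
    ⟪ α , x ⟫ₚ = sum4ₚ λ i → α i :* x i

    _·ₘₚ_ : Matₚ → Matₚ → Matₚ
    (g ·ₘₚ k) i j = sum4ₚ λ l → g i l :* k l j

    _·ᵣₚ_ : Rowₚ → Matₚ → Rowₚ
    (α ·ᵣₚ g) j = sum4ₚ λ i → α i :* g i j

    _^ₚ_ : Polynomial n → ℕ → Polynomial n
    x ^ₚ zero = con 1ℚ
    x ^ₚ suc k = x :* x ^ₚ k

    Uₚ : Polynomial n → Matₚ
    Uₚ t 0F 2F = t
    Uₚ t 1F 3F = t
    Uₚ t i j = con (δ i j)

    sMatₚ : Polynomial n → Matₚ
    sMatₚ x 0F 0F = x
    sMatₚ x 1F 1F = x
    sMatₚ x i j = con (δ i j)

    constₚ : Vec4 → Rowₚ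
    constₚ x i = con (x i)

    embVₚ : Vec4 → Rowₚ → Rowₚ → Polynomial n
    embVₚ x α β = ⟪ β , constₚ x ⟫ₚ

    embW₀ₚ : Wedge2 → Rowₚ → Rowₚ → Polynomial n
    embW₀ₚ [] α β = con 0ℚ
    embW₀ₚ ((c , x , y) ∷ ω) α β =
      con c :* (⟪ α , constₚ x ⟫ₚ :* ⟪ β , constₚ y ⟫ₚ :- ⟪ α , constₚ y ⟫ₚ :* ⟪ β , constₚ x ⟫ₚ)
        :+ embW₀ₚ ω α β

    wₚ w′ₚ vₚ v′ₚ : Rowₚ → Rowₚ → Polynomial n
    wₚ = embW₀ₚ wω
    w′ₚ = embW₀ₚ w′ω
    vₚ = embVₚ e₁
    v′ₚ = embVₚ e₂

  open Mirror

  U-+ₚ : Fin 4 → Fin 4 → Polynomial 2 → Polynomial 2 → Polynomial 2 × Polynomial 2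
  U-+ₚ i j s t = (Uₚ s ·ₘₚ Uₚ t) i j := Uₚ (s :+ t) i j

  U-+ : ∀ s t → U s ·ₘ U t ≗ₘ U (s + t)
  U-+ s t 0F 0F = solve 2 (U-+ₚ 0F 0F) refl s t
  U-+ s t 0F 1F = solve 2 (U-+ₚ 0F 1F) refl s t
  U-+ s t 0F 2F = solve 2 (U-+ₚ 0F 2F) refl s t
  U-+ s t 0F 3F = solve 2 (U-+ₚ 0F 3F) refl s t
  U-+ s t 1F 0F = solve 2 (U-+ₚ 1F 0F) refl s t
  U-+ s t 1F 1F = solve 2 (U-+ₚ 1F 1F) refl s t
  U-+ s t 1F 2F = solve 2 (U-+ₚ 1F 2F) refl s t
  U-+ s t 1F 3F = solve 2 (U-+ₚ 1F 3F) refl s t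
  U-+ s t 2F 0F = solve 2 (U-+ₚ 2F 0F) refl s t
  U-+ s t 2F 1F = solve 2 (U-+ₚ 2F 1F) refl s t
  U-+ s t 2F 2F = solve 2 (U-+ₚ 2F 2F) refl s t
  U-+ s t 2F 3F = solve 2 (U-+ₚ 2F 3F) refl s t
  U-+ s t 3F 0F = solve 2 (U-+ₚ 3F 0F) refl s t
  U-+ s t 3F 1F = solve 2 (U-+ₚ 3F 1F) refl s t
  U-+ s t 3F 2F = solve 2 (U-+ₚ 3F 2F) refl s t
  U-+ s t 3F 3F = solve 2 (U-+ₚ 3F 3F) refl s t

  ·ₘ-U : ∀ {g k s t} → g ≗ₘ U s → k ≗ₘ U t → g ·ₘ k ≗ₘ U (s + t)
  ·ₘ-U g≗Us k≗Ut i j = trans (·ₘ-cong g≗Us k≗Ut i j) (U-+ _ _ i j)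

  -- fromℤ z has denominator exactly 1, so fromℤ x + fromℤ y unfolds to a fraction over 1.
  ℤ→ℚ-+ : ∀ x y → ℤ→ℚ (x ℤ.+ y) ≡ ℤ→ℚ x + ℤ→ℚ y
  ℤ→ℚ-+ x y = begin
    (x ℤ.+ y) / 1                  ≡⟨ cong (_/ 1) (cong₂ ℤ._+_ (sym (ℤ.*-identityʳ x)) (sym (ℤ.*-identityʳ y))) ⟩
    (x ℤ.* + 1 ℤ.+ y ℤ.* + 1) / 1  ≡⟨⟩
    fromℤ x + fromℤ y              ≡⟨ cong₂ _+_ (↥p/↧p≡p (fromℤ x)) (↥p/↧p≡p (fromℤ y)) ⟨
    ℤ→ℚ x + ℤ→ℚ y                  ∎

  ℤ→ℚ-double : ∀ h → ℤ→ℚ (+ 2 ℤ.* h) ≡ ℤ→ℚ h + ℤ→ℚ h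
  ℤ→ℚ-double h = begin
    ℤ→ℚ (+ 2 ℤ.* h)                ≡⟨ cong ℤ→ℚ (ℤ.*-distribʳ-+ h (+ 1) (+ 1)) ⟩
    ℤ→ℚ (+ 1 ℤ.* h ℤ.+ + 1 ℤ.* h)  ≡⟨ cong ℤ→ℚ (cong₂ ℤ._+_ (ℤ.*-identityˡ h) (ℤ.*-identityˡ h)) ⟩
    ℤ→ℚ (h ℤ.+ h)                  ≡⟨ ℤ→ℚ-+ h h ⟩
    ℤ→ℚ h + ℤ→ℚ h                  ∎

  uPow≗ₘU : ∀ h → uPow h ≗ₘ U (ℤ→ℚ h)
  uPow≗ₘU (+ n) = uⁿ n
    where
    u≗ₘU1 : u ≗ₘ U 1ℚ
    u≗ₘU1 = toWitness {a? = u ≗ₘ? U 1ℚ} _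
    uⁿ : ∀ n → matPow u n ≗ₘ U (ℤ→ℚ (+ n))
    uⁿ zero = toWitness {a? = idM ≗ₘ? U 0ℚ} _
    uⁿ (suc n) = subst (λ t → matPow u (suc n) ≗ₘ U t) (sym (ℤ→ℚ-+ (+ 1) (+ n))) (·ₘ-U u≗ₘU1 (uⁿ n))
  uPow≗ₘU -[1+ n ] = u⁻ⁿ n
    where
    u⁻¹≗ₘU-1 : spInv u ≗ₘ U (- 1ℚ)
    u⁻¹≗ₘU-1 = toWitness {a? = spInv u ≗ₘ? U (- 1ℚ)} _
    u⁻ⁿ : ∀ n → matPow (spInv u) (suc n) ≗ₘ U (ℤ→ℚ -[1+ n ])
    u⁻ⁿ zero = toWitness {a? = matPow (spInv u) 1 ≗ₘ? U (- 1ℚ)} _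
    u⁻ⁿ (suc n) = subst (λ t → matPow (spInv u) (suc (suc n)) ≗ₘ U t) (sym (ℤ→ℚ-+ -[1+ 0 ] -[1+ n ]))
                        (·ₘ-U u⁻¹≗ₘU-1 (u⁻ⁿ n))

  coordinates : ℚ → Vec4 → Vec4 → Vec ℚ 9
  coordinates t α β = t ∷ α 0F ∷ α 1F ∷ α 2F ∷ α 3F ∷ β 0F ∷ β 1F ∷ β 2F ∷ β 3F ∷ []

  tₚ : Polynomial 9
  tₚ = var 0F

  αₚ βₚ : Rowₚ
  αₚ i = var (suc (i ↑ˡ 4))
  βₚ i = var (suc (4 ↑ʳ i))

  act-U-w : ∀ t α β → act (U t) w α β ≡ w α β
  act-U-w t α β = prove (coordinates t α β) (wₚ (αₚ ·ᵣₚ Uₚ tₚ) (βₚ ·ᵣₚ Uₚ tₚ)) (wₚ αₚ βₚ) refl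

  act-U-v : ∀ t α β → act (U t) v α β ≡ v α β
  act-U-v t α β = prove (coordinates t α β) (vₚ (αₚ ·ᵣₚ Uₚ tₚ) (βₚ ·ᵣₚ Uₚ tₚ)) (vₚ αₚ βₚ) refl

  act-U-v′ : ∀ t α β → act (U t) v′ α β ≡ v′ α β
  act-U-v′ t α β = prove (coordinates t α β) (v′ₚ (αₚ ·ᵣₚ Uₚ tₚ) (βₚ ·ᵣₚ Uₚ tₚ)) (v′ₚ αₚ βₚ) refl

  act-U-w′ : ∀ t α β → act (U t) w′ α β ≡ w′ α β + (t + t) * w α β
  act-U-w′ t α β = prove (coordinates t α β) (w′ₚ (αₚ ·ᵣₚ Uₚ tₚ) (βₚ ·ᵣₚ Uₚ tₚ))
                                             (w′ₚ αₚ βₚ :+ (tₚ :+ tₚ) :* wₚ αₚ βₚ) refl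

  Respects≗ : Fn → Set
  Respects≗ F = ∀ {α α′ β β′} → α ≗ α′ → β ≗ β′ → F α β ≡ F α′ β′

  ⟪⟫-congˡ : ∀ {α α′} x → α ≗ α′ → ⟪ α , x ⟫ ≡ ⟪ α′ , x ⟫
  ⟪⟫-congˡ x α≗α′ = sum4-cong λ i → cong (_* x i) (α≗α′ i)

  embV-respects : ∀ x → Respects≗ (embV x)
  embV-respects x _ β≗β′ = ⟪⟫-congˡ x β≗β′

  embW₀-respects : ∀ ω → Respects≗ (embW₀ ω)
  embW₀-respects [] _ _ = refl
  embW₀-respects ((c , x , y) ∷ ω) α≗α′ β≗β′ =
    cong₂ _+_ (cong (c *_) (cong₂ _-_ (cong₂ _*_ (⟪⟫-congˡ x α≗α′) (⟪⟫-congˡ y β≗β′))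
                                      (cong₂ _*_ (⟪⟫-congˡ y α≗α′) (⟪⟫-congˡ x β≗β′))))
              (embW₀-respects ω α≗α′ β≗β′)

  act-uPow : ∀ {F} → Respects≗ F → ∀ h α β → act (uPow h) F α β ≡ act (U (ℤ→ℚ h)) F α β
  act-uPow F-resp h α β = F-resp (·ᵣ-congʳ α (uPow≗ₘU h)) (·ᵣ-congʳ β (uPow≗ₘU h))

  ^≡^ᴿ : ∀ x n → x ^ n ≡ x ^ᴿ n
  ^≡^ᴿ x zero = refl
  ^≡^ᴿ x (suc n) = cong (x *_) (^≡^ᴿ x n)

  ^-+ : ∀ x m n → x ^ (m ℕ.+ n) ≡ x ^ m * x ^ n
  ^-+ x m n rewrite ^≡^ᴿ x (m ℕ.+ n) | ^≡^ᴿ x m | ^≡^ᴿ x n = ^-homo-* x m n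

  ^-* : ∀ x y n → (x * y) ^ n ≡ x ^ n * y ^ n
  ^-* x y n rewrite ^≡^ᴿ (x * y) n | ^≡^ᴿ x n | ^≡^ᴿ y n = ^-distrib-* x y n

  ^ᶜ-eval : ∀ F n α β → (F ^ᶜ n) α β ≡ F α β ^ n
  ^ᶜ-eval F zero α β = refl
  ^ᶜ-eval F (suc n) α β = cong (F α β *_) (^ᶜ-eval F n α β)

  cartanMonomial : ℕ → ℕ → ℕ → ℕ → Fn
  cartanMonomial i j k l = (w ^ᶜ i) ⊗ ((v ^ᶜ j) ⊗ ((w′ ^ᶜ k) ⊗ (v′ ^ᶜ l)))

  cartanMonomial-eval : ∀ i j k l α β →
    cartanMonomial i j k l α β ≡ w α β ^ i * (v α β ^ j * (w′ α β ^ k * v′ α β ^ l))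
  cartanMonomial-eval i j k l α β =
    cong₂ _*_ (^ᶜ-eval w i α β) (cong₂ _*_ (^ᶜ-eval v j α β) (cong₂ _*_ (^ᶜ-eval w′ k α β) (^ᶜ-eval v′ l α β)))

  act-uPow-cartanMonomial : ∀ h i j k l α β → let c = ℤ→ℚ (+ 2 ℤ.* h) in
    act (uPow h) (cartanMonomial i j k l) α β
      ≡ w α β ^ i * (v α β ^ j * ((w′ α β + c * w α β) ^ k * v′ α β ^ l))
  act-uPow-cartanMonomial h i j k l α β = begin
    cartanMonomial i j k l αᵘ βᵘ
      ≡⟨ cartanMonomial-eval i j k l αᵘ βᵘ ⟩
    w αᵘ βᵘ ^ i * (v αᵘ βᵘ ^ j * (w′ αᵘ βᵘ ^ k * v′ αᵘ βᵘ ^ l))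
      ≡⟨ cong₂ _*_ (cong (_^ i) w-law)
           (cong₂ _*_ (cong (_^ j) v-law) (cong₂ _*_ (cong (_^ k) w′-law) (cong (_^ l) v′-law))) ⟩
    w α β ^ i * (v α β ^ j * ((w′ α β + ℤ→ℚ (+ 2 ℤ.* h) * w α β) ^ k * v′ α β ^ l)) ∎
    where
    αᵘ βᵘ : Vec4
    αᵘ = α ·ᵣ uPow h
    βᵘ = β ·ᵣ uPow h
    t : ℚ
    t = ℤ→ℚ h
    w-law : w αᵘ βᵘ ≡ w α β
    w-law = trans (act-uPow (embW₀-respects wω) h α β) (act-U-w t α β)
    v-law : v αᵘ βᵘ ≡ v α β
    v-law = trans (act-uPow (embV-respects e₁) h α β) (act-U-v t α β)
    v′-law : v′ αᵘ βᵘ ≡ v′ α β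
    v′-law = trans (act-uPow (embV-respects e₂) h α β) (act-U-v′ t α β)
    w′-law : w′ αᵘ βᵘ ≡ w′ α β + ℤ→ℚ (+ 2 ℤ.* h) * w α β
    w′-law = trans (act-uPow (embW₀-respects w′ω) h α β)
                   (trans (act-U-w′ t α β) (cong (λ c → w′ α β + c * w α β) (sym (ℤ→ℚ-double h))))

  HasSWeight-zeroF : ∀ n → HasSWeight n zeroF
  HasSWeight-zeroF n x _ _ _ _ = sym (*-zeroʳ (x ^ n))

  HasSWeight-oneF : HasSWeight 0 oneF
  HasSWeight-oneF _ _ _ _ _ = refl

  HasSWeight-scale : ∀ {n F} c → HasSWeight n F → HasSWeight n (scale c F)
  HasSWeight-scale {n} {F} c F-wt x x≢0 α β iso = begin
    c * act (sMat x) F α β  ≡⟨ cong (c *_) (F-wt x x≢0 α β iso) ⟩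
    c * (x ^ n * F α β)     ≡⟨ solve 3 (λ c p f → c :* (p :* f) := p :* (c :* f)) refl c (x ^ n) (F α β) ⟩
    x ^ n * (c * F α β)     ∎

  HasSWeight-⊗ : ∀ {m n F G} → HasSWeight m F → HasSWeight n G → HasSWeight (m ℕ.+ n) (F ⊗ G)
  HasSWeight-⊗ {m} {n} {F} {G} F-wt G-wt x x≢0 α β iso = begin
    act (sMat x) F α β * act (sMat x) G α β  ≡⟨ cong₂ _*_ (F-wt x x≢0 α β iso) (G-wt x x≢0 α β iso) ⟩
    (x ^ m * F α β) * (x ^ n * G α β)        ≡⟨ solve 4 (λ p q f g → (p :* f) :* (q :* g) := (p :* q) :* (f :* g))
                                                       refl (x ^ m) (x ^ n) (F α β) (G α β) ⟩
    (x ^ m * x ^ n) * (F α β * G α β)        ≡⟨ cong (_* (F α β * G α β)) (^-+ x m n) ⟨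
    x ^ (m ℕ.+ n) * (F α β * G α β)          ∎

  HasSWeight-^ᶜ : ∀ {m F} → HasSWeight m F → ∀ n → HasSWeight (n ℕ.* m) (F ^ᶜ n)
  HasSWeight-^ᶜ F-wt zero = HasSWeight-oneF
  HasSWeight-^ᶜ {m} {F} F-wt (suc n) = HasSWeight-⊗ {m} {n ℕ.* m} {F} {F ^ᶜ n} F-wt (HasSWeight-^ᶜ F-wt n)

  HasSWeight-w : HasSWeight 2 w
  HasSWeight-w x _ α β _ =
    prove (coordinates x α β) (wₚ (αₚ ·ᵣₚ sMatₚ tₚ) (βₚ ·ᵣₚ sMatₚ tₚ)) (tₚ ^ₚ 2 :* wₚ αₚ βₚ) refl

  HasSWeight-v : HasSWeight 1 v
  HasSWeight-v x _ α β _ =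
    prove (coordinates x α β) (vₚ (αₚ ·ᵣₚ sMatₚ tₚ) (βₚ ·ᵣₚ sMatₚ tₚ)) (tₚ ^ₚ 1 :* vₚ αₚ βₚ) refl

  HasSWeight-v′ : HasSWeight 1 v′
  HasSWeight-v′ x _ α β _ =
    prove (coordinates x α β) (v′ₚ (αₚ ·ᵣₚ sMatₚ tₚ) (βₚ ·ᵣₚ sMatₚ tₚ)) (tₚ ^ₚ 1 :* v′ₚ αₚ βₚ) refl

  HasSWeight-w′ : HasSWeight 1 w′
  HasSWeight-w′ x _ α β _ =
    prove (coordinates x α β) (w′ₚ (αₚ ·ᵣₚ sMatₚ tₚ) (βₚ ·ᵣₚ sMatₚ tₚ)) (tₚ ^ₚ 1 :* w′ₚ αₚ βₚ) refl

  HasSWeight-cartanMonomial : ∀ i j k l → HasSWeight (2 ℕ.* i ℕ.+ j ℕ.+ k ℕ.+ l) (cartanMonomial i j k l)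
  HasSWeight-cartanMonomial i j k l =
    -- the weights are passed explicitly: Agda cannot infer them through the unfolding of HasSWeight
    subst (λ n → HasSWeight n (cartanMonomial i j k l)) (weight-sum i j k l)
      (HasSWeight-⊗ {m = i ℕ.* 2} Wⁱ (HasSWeight-⊗ {m = j ℕ.* 1} Vʲ (HasSWeight-⊗ {m = k ℕ.* 1} W′ᵏ V′ˡ)))
    where
    Wⁱ : HasSWeight (i ℕ.* 2) (w ^ᶜ i)
    Wⁱ = HasSWeight-^ᶜ HasSWeight-w i
    Vʲ : HasSWeight (j ℕ.* 1) (v ^ᶜ j)
    Vʲ = HasSWeight-^ᶜ HasSWeight-v j
    W′ᵏ : HasSWeight (k ℕ.* 1) (w′ ^ᶜ k)
    W′ᵏ = HasSWeight-^ᶜ HasSWeight-w′ k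
    V′ˡ : HasSWeight (l ℕ.* 1) (v′ ^ᶜ l)
    V′ˡ = HasSWeight-^ᶜ HasSWeight-v′ l
    weight-sum : ∀ i j k l → i ℕ.* 2 ℕ.+ (j ℕ.* 1 ℕ.+ (k ℕ.* 1 ℕ.+ l ℕ.* 1)) ≡ 2 ℕ.* i ℕ.+ j ℕ.+ k ℕ.+ l
    weight-sum = solve-∀

  wᵥ w′ᵥ : V10
  wᵥ = wω , refl
  w′ᵥ = w′ω , refl

  module _ (α β : Vec4) where
    prodW-++ : ∀ {m n} (ωs : Vec V10 m) (ωs′ : Vec V10 n) →
               prodW (ωs ++ ωs′) α β ≡ prodW ωs α β * prodW ωs′ α β
    prodW-++ [] ωs′ = sym (*-identityˡ (prodW ωs′ α β))
    prodW-++ (ω ∷ ωs) ωs′ = trans (cong (embW ω α β *_) (prodW-++ ωs ωs′))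
                                  (sym (*-assoc (embW ω α β) (prodW ωs α β) (prodW ωs′ α β)))

    prodV-++ : ∀ {m n} (xs : Vec Vec4 m) (xs′ : Vec Vec4 n) →
               prodV (xs ++ xs′) α β ≡ prodV xs α β * prodV xs′ α β
    prodV-++ [] xs′ = sym (*-identityˡ (prodV xs′ α β))
    prodV-++ (x ∷ xs) xs′ = trans (cong (embV x α β *_) (prodV-++ xs xs′))
                                  (sym (*-assoc (embV x α β) (prodV xs α β) (prodV xs′ α β)))

    prodW-replicate : ∀ n ω → prodW (replicate n ω) α β ≡ (embW ω ^ᶜ n) α β
    prodW-replicate zero ω = refl
    prodW-replicate (suc n) ω = cong (embW ω α β *_) (prodW-replicate n ω)

    prodV-replicate : ∀ n x → prodV (replicate n x) α β ≡ (embV x ^ᶜ n) α β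
    prodV-replicate zero x = refl
    prodV-replicate (suc n) x = cong (embV x α β *_) (prodV-replicate n x)

  InV-scale-cartanMonomial : ∀ c i j k l → InV (i ℕ.+ k) (j ℕ.+ l) (scale c (cartanMonomial i j k l))
  InV-scale-cartanMonomial c i j k l = (c , ωs , xs) ∷ [] , λ α β _ → begin
    c * cartanMonomial i j k l α β
      ≡⟨ solve 5 (λ c W V W′ V′ → c :* (W :* (V :* (W′ :* V′))) := c :* ((W :* W′) :* (V :* V′)) :+ con 0ℚ)
               refl c ((w ^ᶜ i) α β) ((v ^ᶜ j) α β) ((w′ ^ᶜ k) α β) ((v′ ^ᶜ l) α β) ⟩
    c * (((w ^ᶜ i) α β * (w′ ^ᶜ k) α β) * ((v ^ᶜ j) α β * (v′ ^ᶜ l) α β)) + 0ℚ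
      ≡⟨ cong (λ z → c * z + 0ℚ) (cong₂ _*_ (prodW-ωs α β) (prodV-xs α β)) ⟨
    c * (prodW ωs α β * prodV xs α β) + 0ℚ ∎
    where
    ωs : Vec V10 (i ℕ.+ k)
    ωs = replicate i wᵥ ++ replicate k w′ᵥ
    xs : Vec Vec4 (j ℕ.+ l)
    xs = replicate j e₁ ++ replicate l e₂
    prodW-ωs : ∀ α β → prodW ωs α β ≡ (w ^ᶜ i) α β * (w′ ^ᶜ k) α β
    prodW-ωs α β = trans (prodW-++ α β (replicate i wᵥ) (replicate k w′ᵥ))
                         (cong₂ _*_ (prodW-replicate α β i wᵥ) (prodW-replicate α β k w′ᵥ))
    prodV-xs : ∀ α β → prodV xs α β ≡ (v ^ᶜ j) α β * (v′ ^ᶜ l) α β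
    prodV-xs α β = trans (prodV-++ α β (replicate j e₁) (replicate l e₂))
                         (cong₂ _*_ (prodV-replicate α β j e₁) (prodV-replicate α β l e₂))

  InV-zeroF : ∀ a b → InV a b zeroF
  InV-zeroF a b = [] , λ _ _ _ → refl

  sumUpTo-suc : ∀ n G α β → sumUpTo (suc n) G α β ≡ G 0 α β + sumUpTo n (G ∘ suc) α β
  sumUpTo-suc zero G α β = refl
  sumUpTo-suc (suc n) G α β =
    trans (cong (_+ G (suc (suc n)) α β) (sumUpTo-suc n G α β)) (+-assoc (G 0 α β) _ _)

  sumUpTo≡∑ : ∀ n G α β → sumUpTo n G α β ≡ ∑[ k ≤ n ] G (toℕ k) α β
  sumUpTo≡∑ zero G α β = sym (+-identityʳ (G 0 α β))
  sumUpTo≡∑ (suc n) G α β =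
    trans (sumUpTo-suc n G α β) (cong (_+_ (G 0 α β)) (sumUpTo≡∑ n (G ∘ suc) α β))

  pad : ℕ → (ℕ → Fn) → ℕ → Fn
  pad zero G = G
  pad (suc m) G zero = zeroF
  pad (suc m) G (suc j) = pad m G j

  pad-+ : ∀ m G k → pad m G (m ℕ.+ k) ≡ G k
  pad-+ zero G k = refl
  pad-+ (suc m) G k = pad-+ m G k

  sumUpTo-pad : ∀ m n G α β → sumUpTo (m ℕ.+ n) (pad m G) α β ≡ sumUpTo n G α β
  sumUpTo-pad zero n G α β = refl
  sumUpTo-pad (suc m) n G α β =
    trans (sumUpTo-suc (m ℕ.+ n) (pad (suc m) G) α β) (trans (+-identityˡ _) (sumUpTo-pad m n G α β))

  pad-All : ∀ (P : ℕ → Fn → Set) m n G → (∀ j → P j zeroF) → (∀ k → k ℕ.≤ n → P (m ℕ.+ k) (G k)) →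
            ∀ j → j ℕ.≤ m ℕ.+ n → P j (pad m G j)
  pad-All P zero n G P-zero P-G j j≤n = P-G j j≤n
  pad-All P (suc m) n G P-zero P-G zero _ = P-zero zero
  pad-All P (suc m) n G P-zero P-G (suc j) (ℕ.s≤s j≤m+n) =
    pad-All (P ∘ suc) m n G (P-zero ∘ suc) P-G j j≤m+n

  ×ₙ-as-* : ∀ n x → n ×ₙ x ≡ (n ×ₙ 1ℚ) * x
  ×ₙ-as-* n x = trans (cong (n ×ₙ_) (sym (*-identityˡ x))) (sym (×-assoc-* n 1ℚ x))

  module _ (i j q r : ℕ) (h : ℤ) where
    private
      c : ℚ
      c = ℤ→ℚ (+ 2 ℤ.* h)

    baseWeight : ℕ
    baseWeight = 2 ℕ.* i ℕ.+ j ℕ.+ q ℕ.+ r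

    binomialComponent : ℕ → Fn
    binomialComponent k = scale ((q C k) ×ₙ (c ^ k)) (cartanMonomial (i ℕ.+ k) j (q ∸ k) r)

    binomialComponent-InV : ∀ {k} → k ℕ.≤ q → InV (i ℕ.+ q) (j ℕ.+ r) (binomialComponent k)
    binomialComponent-InV {k} k≤q = subst (λ a → InV a (j ℕ.+ r) (binomialComponent k)) i+k+[q∸k]≡i+q
      (InV-scale-cartanMonomial ((q C k) ×ₙ (c ^ k)) (i ℕ.+ k) j (q ∸ k) r)
      where
      i+k+[q∸k]≡i+q : i ℕ.+ k ℕ.+ (q ∸ k) ≡ i ℕ.+ q
      i+k+[q∸k]≡i+q = trans (ℕ.+-assoc i k (q ∸ k)) (cong (i ℕ.+_) (ℕ.m+[n∸m]≡n k≤q))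

    binomialComponent-weight : ∀ {k} → k ℕ.≤ q → HasSWeight (baseWeight ℕ.+ k) (binomialComponent k)
    binomialComponent-weight {k} k≤q = HasSWeight-scale {baseWeight ℕ.+ k} ((q C k) ×ₙ (c ^ k))
      (subst (λ n → HasSWeight n (cartanMonomial (i ℕ.+ k) j (q ∸ k) r)) weight≡
        (HasSWeight-cartanMonomial (i ℕ.+ k) j (q ∸ k) r))
      where
      rearrange : ∀ i j d k r → 2 ℕ.* (i ℕ.+ k) ℕ.+ j ℕ.+ d ℕ.+ r ≡ 2 ℕ.* i ℕ.+ j ℕ.+ (d ℕ.+ k) ℕ.+ r ℕ.+ k
      rearrange = solve-∀
      weight≡ : 2 ℕ.* (i ℕ.+ k) ℕ.+ j ℕ.+ (q ∸ k) ℕ.+ r ≡ baseWeight ℕ.+ k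
      weight≡ = trans (rearrange i j (q ∸ k) k r)
                      (cong (λ q → 2 ℕ.* i ℕ.+ j ℕ.+ q ℕ.+ r ℕ.+ k) (ℕ.m∸n+n≡m k≤q))

    binomialComponent-top : binomialComponent q ≈ scale (c ^ q) (cartanMonomial (i ℕ.+ q) j 0 r)
    binomialComponent-top α β _ =
      cong₂ _*_ (trans (cong (_×ₙ (c ^ q)) (nCn≡1 q)) (+-identityʳ (c ^ q)))
                (cong (λ d → cartanMonomial (i ℕ.+ q) j d r α β) (ℕ.n∸n≡0 q))

    binomialComponent-eval : ∀ α β (k : Fin (suc q)) → let W = w α β ; W′ = w′ α β in
      binomialComponent (toℕ k) α β ≡ W ^ i * (v α β ^ j * (binomialTerm (c * W) W′ q k * v′ α β ^ r))
    binomialComponent-eval α β k = begin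
      (N ×ₙ (c ^ n)) * cartanMonomial (i ℕ.+ n) j (q ∸ n) r α β
        ≡⟨ cong₂ _*_ (×ₙ-as-* N (c ^ n)) (cartanMonomial-eval (i ℕ.+ n) j (q ∸ n) r α β) ⟩
      (N′ * c ^ n) * (W ^ (i ℕ.+ n) * (Vʲ * (W′ ^ (q ∸ n) * V′ʳ)))
        ≡⟨ cong (λ z → (N′ * c ^ n) * (z * (Vʲ * (W′ ^ (q ∸ n) * V′ʳ)))) (^-+ W i n) ⟩
      (N′ * c ^ n) * ((W ^ i * W ^ n) * (Vʲ * (W′ ^ (q ∸ n) * V′ʳ)))
        ≡⟨ solve 7 (λ N′ cⁿ Wⁱ Wⁿ Vʲ W′ᵈ V′ʳ → (N′ :* cⁿ) :* ((Wⁱ :* Wⁿ) :* (Vʲ :* (W′ᵈ :* V′ʳ)))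
                                            := Wⁱ :* (Vʲ :* ((N′ :* ((cⁿ :* Wⁿ) :* W′ᵈ)) :* V′ʳ)))
                 refl N′ (c ^ n) (W ^ i) (W ^ n) Vʲ (W′ ^ (q ∸ n)) V′ʳ ⟩
      W ^ i * (Vʲ * ((N′ * ((c ^ n * W ^ n) * W′ ^ (q ∸ n))) * V′ʳ))
        ≡⟨ cong (λ z → W ^ i * (Vʲ * (z * V′ʳ))) (begin
             N′ * ((c ^ n * W ^ n) * W′ ^ (q ∸ n))
               ≡⟨ cong (λ z → N′ * (z * W′ ^ (q ∸ n))) (^-* c W n) ⟨
             N′ * ((c * W) ^ n * W′ ^ (q ∸ n))
               ≡⟨ ×ₙ-as-* N _ ⟨
             N ×ₙ ((c * W) ^ n * W′ ^ (q ∸ n))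
               ≡⟨ cong (N ×ₙ_) (cong₂ _*_ (^≡^ᴿ (c * W) n) (^≡^ᴿ W′ (q ∸ n))) ⟩
             binomialTerm (c * W) W′ q k ∎) ⟩
      W ^ i * (Vʲ * (binomialTerm (c * W) W′ q k * V′ʳ)) ∎
      where
      n : ℕ
      n = toℕ k
      N : ℕ
      N = q C n
      N′ W Vʲ W′ V′ʳ : ℚ
      N′ = N ×ₙ 1ℚ
      W = w α β
      Vʲ = v α β ^ j
      W′ = w′ α β
      V′ʳ = v′ α β ^ r

    binomialComponent-sum : act (uPow h) (cartanMonomial i j q r) ≈ sumUpTo q binomialComponent
    binomialComponent-sum α β _ = begin
      act (uPow h) (cartanMonomial i j q r) α β
        ≡⟨ act-uPow-cartanMonomial h i j q r α β ⟩
      Wⁱ * (Vʲ * ((W′ + c * W) ^ q * V′ʳ))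
        ≡⟨ cong (λ z → Wⁱ * (Vʲ * (z * V′ʳ))) (trans (cong (_^ q) (+-comm W′ (c * W))) (^≡^ᴿ (c * W + W′) q)) ⟩
      Wⁱ * (Vʲ * ((c * W + W′) ^ᴿ q * V′ʳ))
        ≡⟨ cong (λ z → Wⁱ * (Vʲ * (z * V′ʳ))) (theorem q (c * W) W′) ⟩
      Wⁱ * (Vʲ * ((∑[ k ≤ q ] T k) * V′ʳ))
        ≡⟨ cong (λ z → Wⁱ * (Vʲ * z)) (*-distribʳ-sum V′ʳ T) ⟩
      Wⁱ * (Vʲ * ∑[ k ≤ q ] (T k * V′ʳ))
        ≡⟨ cong (Wⁱ *_) (*-distribˡ-sum Vʲ (λ k → T k * V′ʳ)) ⟩
      Wⁱ * ∑[ k ≤ q ] (Vʲ * (T k * V′ʳ))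
        ≡⟨ *-distribˡ-sum Wⁱ (λ k → Vʲ * (T k * V′ʳ)) ⟩
      ∑[ k ≤ q ] (Wⁱ * (Vʲ * (T k * V′ʳ)))
        ≡⟨ sum-cong-≗ (binomialComponent-eval α β) ⟨
      ∑[ k ≤ q ] binomialComponent (toℕ k) α β
        ≡⟨ sumUpTo≡∑ q binomialComponent α β ⟨
      sumUpTo q binomialComponent α β ∎
      where
      W W′ Wⁱ Vʲ V′ʳ : ℚ
      W = w α β
      W′ = w′ α β
      Wⁱ = W ^ i
      Vʲ = v α β ^ j
      V′ʳ = v′ α β ^ r
      T : Fin (suc q) → ℚ
      T = binomialTerm (c * W) W′ q

    highestSProj-cartanMonomial :
      IsHighestSProj (i ℕ.+ q) (j ℕ.+ r) (act (uPow h) (cartanMonomial i j q r)) (scale (c ^ q) (cartanMonomial (i ℕ.+ q) j 0 r))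
    highestSProj-cartanMonomial = pad baseWeight binomialComponent , graded , decomposition , highest
      where
      top : ℕ
      top = 2 ℕ.* (i ℕ.+ q) ℕ.+ (j ℕ.+ r)
      rearrange : ∀ i j q r → 2 ℕ.* (i ℕ.+ q) ℕ.+ (j ℕ.+ r) ≡ 2 ℕ.* i ℕ.+ j ℕ.+ q ℕ.+ r ℕ.+ q
      rearrange = solve-∀
      top≡ : top ≡ baseWeight ℕ.+ q
      top≡ = rearrange i j q r
      graded : ∀ n → n ℕ.≤ top → InV (i ℕ.+ q) (j ℕ.+ r) (pad baseWeight binomialComponent n)
                                 × HasSWeight n (pad baseWeight binomialComponent n)
      graded n n≤top = pad-All (λ n F → InV (i ℕ.+ q) (j ℕ.+ r) F × HasSWeight n F) baseWeight q binomialComponent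
        (λ n → InV-zeroF (i ℕ.+ q) (j ℕ.+ r) , HasSWeight-zeroF n)
        (λ k k≤q → binomialComponent-InV k≤q , binomialComponent-weight k≤q)
        n (subst (n ℕ.≤_) top≡ n≤top)
      decomposition : act (uPow h) (cartanMonomial i j q r) ≈ sumUpTo top (pad baseWeight binomialComponent)
      decomposition α β iso = begin
        act (uPow h) (cartanMonomial i j q r) α β
          ≡⟨ binomialComponent-sum α β iso ⟩
        sumUpTo q binomialComponent α β
          ≡⟨ sumUpTo-pad baseWeight q binomialComponent α β ⟨
        sumUpTo (baseWeight ℕ.+ q) (pad baseWeight binomialComponent) α β
          ≡⟨ cong (λ n → sumUpTo n (pad baseWeight binomialComponent) α β) top≡ ⟨
        sumUpTo top (pad baseWeight binomialComponent) α β ∎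
      highest : scale (c ^ q) (cartanMonomial (i ℕ.+ q) j 0 r) ≈ pad baseWeight binomialComponent top
      highest α β iso = begin
        scale (c ^ q) (cartanMonomial (i ℕ.+ q) j 0 r) α β
          ≡⟨ binomialComponent-top α β iso ⟨
        binomialComponent q α β
          ≡⟨ cong (λ F → F α β) (pad-+ baseWeight binomialComponent q) ⟨
        pad baseWeight binomialComponent (baseWeight ℕ.+ q) α β
          ≡⟨ cong (λ n → pad baseWeight binomialComponent n α β) top≡ ⟨
        pad baseWeight binomialComponent top α β ∎

open import Data.Nat using (ℕ; _≤_)
open import Data.Integer using (ℤ; +_; _*_)
open import Relation.Binary.PropositionalEquality using (_≢_)
open import Data.Nat using (_∸_)
open import Data.Nat.Properties using (m∸n+n≡m)
open import Relation.Binary.PropositionalEquality using (subst₂)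

lemma4p4p2 : (a b q r : ℕ) → q ≤ a → r ≤ b → (h : ℤ) → h ≢ + 0 →
    IsHighestSProj a b (act (uPow h) (vabqr a b q r))
      (scale (ℤ→ℚ (+ 2 * h) ^ q) (vabqr a b 0 r))
lemma4p4p2 a b q r q≤a r≤b h _ =
  subst₂ (λ a′ b′ → IsHighestSProj a′ b′ (act (uPow h) (vabqr a b q r))
                                         (scale (ℤ→ℚ (+ 2 * h) ^ q) (cartanMonomial a′ (b ∸ r) 0 r)))
         (m∸n+n≡m q≤a) (m∸n+n≡m r≤b)
         (highestSProj-cartanMonomial (a ∸ q) (b ∸ r) q r h)
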